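{- Let $m\ge1$ and let $\mathcal{T}(t,a,b)$ be a binary double Toeplitz code with $t\in\mathbb{F}_2$, $a,b\in\mathbb{F}_2^{m-1}$. Then there is a binary double Toeplitz code $\mathcal{T}(t',a',b')$ such that (C1) $\mathcal{T}(t,a,b)\cong\mathcal{T}(t',a',b')$, and (C2) $(t',a')\ge(t',b')$.
   Context: For $t\in\mathbb{F}_q$, $a=(a_1,\dots,a_{m-1})$, $b=(b_1,\dots,b_{m-1})\in\mathbb{F}_q^{m-1}$, $T(t,a,b)$ is the $m\times m$ matrix whose $(i,j)$ entry is $t$ if $i=j$, $a_{j-i}$ if $j>i$, and $b_{i-j}$ if $i>j$; $\mathcal{T}(t,a,b)$ is the code with generator matrix $(I_m\mid T(t,a,b))$. Codes $C,C'$ of length $N$ are equivalent ($C\cong C'$) if $C'=\{xP:x\in C\}$ for some $N\times N$ monomial matrix $P$. Ordering on $\mathbb{F}_2^k$: with $g(0)=0,g(1)=1$ and $f(c_1,\dots,c_k)=\sum_{i=1}^k 2^{i-1}g(c_i)\in\mathbb{Z}$, write $c\ge c'$ iff $f(c)\ge f(c')$; here $(t',a')$ denotes the vector $(t',a'_1,\dots,a'_{m-1})\in\mathbb{F}_2^m$. -}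

module Defs where

open import Data.Bool using (Bool; true; false; _xor_; _∧_)
open import Data.Nat using (ℕ; zero; suc; _+_; _*_; _∸_; _<_; _≥_; _<ᵇ_)
open import Data.Fin using (Fin; toℕ; fromℕ<; _≟_)
open import Data.Vec using (Vec; []; _∷_; lookup; tabulate; _++_; replicate; zipWith; foldr; map)
open import Data.Product using (Σ; ∃; _×_; _,_)
open import Relation.Binary.PropositionalEquality using (_≡_)
open import Relation.Nullary using (does)
open import Function.Bundles using (_⇔_)

-- The binary field F₂ is Bool with xor as addition and ∧ as multiplication.
F₂ : Set
F₂ = Bool

Matrix : ℕ → ℕ → Set
Matrix m n = Vec (Vec F₂ n) m

_·_ : ∀ {m n} → Vec F₂ m → Matrix m n → Vec F₂ n
_·_ {n = n} x G = foldr _ (zipWith _xor_) (replicate n false)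
                     (zipWith (λ c row → map (c ∧_) row) x G)

entry : ∀ {m n} → Matrix m n → Fin m → Fin n → F₂
entry G i j = lookup (lookup G i) j

I : (m : ℕ) → Matrix m m
I m = tabulate λ i → tabulate λ j → does (i ≟ j)

-- Entry a_d for 1 ≤ d ≤ k, where the vector a = (a_1,…,a_k) is stored 0-based;
-- returns false outside the range (never used there).
coeff : ∀ {k} → Vec F₂ k → ℕ → F₂
coeff {zero} [] d = false
coeff {suc k} (x ∷ xs) zero = false
coeff {suc k} (x ∷ xs) (suc zero) = x
coeff {suc k} (x ∷ xs) (suc (suc d)) = coeff xs (suc d)

Toeplitz : ∀ {k} → F₂ → Vec F₂ k → Vec F₂ k → Matrix (suc k) (suc k)
Toeplitz t a b = tabulate λ i → tabulate λ j →
  if-eq i j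
  where
  if-eq : _ → _ → F₂
  if-eq i j with toℕ i <ᵇ toℕ j | toℕ j <ᵇ toℕ i
  ... | true  | _     = coeff a (toℕ j ∸ toℕ i)
  ... | false | true  = coeff b (toℕ i ∸ toℕ j)
  ... | false | false = t

_∣∣_ : ∀ {m n p} → Matrix m n → Matrix m p → Matrix m (n + p)
_∣∣_ = zipWith _++_

_∈Code_ : ∀ {m n} → Vec F₂ n → Matrix m n → Set
x ∈Code G = ∃ λ u → x ≡ u · G

DTGen : ∀ {k} → F₂ → Vec F₂ k → Vec F₂ k → Matrix (suc k) (suc k + suc k)
DTGen {k} t a b = I (suc k) ∣∣ Toeplitz t a b

weight : ∀ {n} → Vec F₂ n → ℕ
weight [] = 0
weight (true ∷ xs) = suc (weight xs)
weight (false ∷ xs) = weight xs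

IsMonomial : ∀ {N} → Matrix N N → Set
IsMonomial {N} P =
  ((i : Fin N) → weight (lookup P i) ≡ 1) ×
  ((j : Fin N) → weight (tabulate (λ i → entry P i j)) ≡ 1)

_≅Code_ : ∀ {m m' N} → Matrix m N → Matrix m' N → Set
_≅Code_ {N = N} G G' = Σ (Matrix N N) λ P → IsMonomial P ×
  ((y : Vec F₂ N) → (y ∈Code G') ⇔ (∃ λ x → (x ∈Code G) × (y ≡ x · P)))

-- Ordering on F₂^k: f(c) = Σ 2^{i-1} g(c_i).
g : F₂ → ℕ
g false = 0
g true = 1

f : ∀ {k} → Vec F₂ k → ℕ
f [] = 0
f (c ∷ cs) = g c + 2 * f cs

_≥F_ : ∀ {k} → Vec F₂ k → Vec F₂ k → Set
c ≥F c' = f c ≥ f c'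

-- Reversing both the row order and the column order of T(t,a,b) yields T(t,b,a): the entry at
-- distance d above the diagonal moves to distance d below it. Hence reversing the message
-- coordinates, together with each of the two blocks of code coordinates, maps 𝒯(t,a,b) onto
-- 𝒯(t,b,a) while fixing the identity block. Since (t,a) and (t,b) share their first coordinate,
-- they compare as a and b do, so (C2) holds for (t,a,b) or for (t,b,a).
{-# OPTIONS --safe #-}
module Submission where

open import Defs
open import Data.Nat using (ℕ)
open import Data.Vec using (Vec; _∷_)
open import Data.Product using (Σ; _×_)

open import Algebra.Bundles using (CommutativeRing)
open import Data.Bool using (true; false; _∧_; _xor_; if_then_else_)
open import Data.Bool.Properties using (xor-∧-commutativeRing; xor-identityʳ; ∧-zeroʳ; ∧-identityʳ)
open import Data.Fin as Fin using (Fin; zero; suc; toℕ; opposite; _↑ˡ_; _↑ʳ_; splitAt; join)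
open import Data.Fin.Permutation as Perm using (Permutation′; _⟨$⟩ʳ_; _⟨$⟩ˡ_)
open import Data.Fin.Properties using (_≟_; <-cmp; toℕ<n; opposite-prop; opposite-involutive; splitAt-↑ˡ; splitAt-↑ʳ; splitAt-join; join-splitAt)
open import Data.Nat as ℕ using (_∸_; _<ᵇ_; _≤_; s≤s)
open import Data.Nat.Properties using (<ᵇ-reflects-<; ≤-total; +-monoʳ-≤; *-monoʳ-≤; m∸[m∸n]≡n; m≤n⇒m∸n≡0; m∸n≤m; m∸n≢0⇒n<m; m>n⇒m∸n≢0; <-irrefl; <⇒≯)
open import Data.Product using (_,_; ∃)
open import Data.Sum as Sum using (_⊎_; inj₁; inj₂)
open import Data.Vec using ([]; lookup; tabulate; map; _++_)
open import Data.Vec.Properties using (lookup∘tabulate; tabulate∘lookup; tabulate-cong; lookup-zipWith; lookup-map; lookup-replicate; lookup-++ˡ; lookup-++ʳ)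
open import Function using (_∘_; _⇔_; mk⇔; Injection)
open import Function.Properties.Inverse using (↔⇒↣)
open import Relation.Binary.Definitions using (tri<; tri≈; tri>)
open import Relation.Binary.PropositionalEquality
open import Relation.Nullary using (¬_; does)
open import Relation.Nullary.Decidable using (does-⇔)
open import Relation.Nullary.Reflects using (ofʸ; ofⁿ; det)

open import Algebra.Properties.CommutativeMonoid.Sum
  (CommutativeRing.+-commutativeMonoid xor-∧-commutativeRing)
  using (sum; sum-cong-≗; sum-replicate-zero; ∑-permute)

open ≡-Reasoning

lookup-extensionality : ∀ {A : Set} {n} {xs ys : Vec A n} →
                        (∀ i → lookup xs i ≡ lookup ys i) → xs ≡ ys
lookup-extensionality {xs = xs} {ys} eq =
  trans (sym (tabulate∘lookup xs)) (trans (tabulate-cong eq) (tabulate∘lookup ys))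

entry-tabulate : ∀ {m n} (h : Fin m → Fin n → F₂) i j →
                 entry (tabulate λ i → tabulate λ j → h i j) i j ≡ h i j
entry-tabulate h i j =
  trans (cong (λ row → lookup row j) (lookup∘tabulate _ i)) (lookup∘tabulate (h i) j)

lookup-· : ∀ {m n} (u : Vec F₂ m) (G : Matrix m n) j →
           lookup (u · G) j ≡ sum (λ i → lookup u i ∧ entry G i j)
lookup-· []      []      j = lookup-replicate j false
lookup-· (c ∷ u) (r ∷ G) j =
  trans (lookup-zipWith _xor_ j (map (c ∧_) r) (u · G))
        (cong₂ _xor_ (lookup-map j (c ∧_) r) (lookup-· u G j))

sum-select : ∀ {n} (h : Fin n → F₂) k → sum (λ i → h i ∧ does (i ≟ k)) ≡ h k
sum-select {ℕ.suc n} h zero = begin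
  h zero ∧ true xor sum (λ i → h (suc i) ∧ false)
    ≡⟨ cong₂ _xor_ (∧-identityʳ (h zero))
                   (trans (sum-cong-≗ (∧-zeroʳ ∘ h ∘ suc)) (sum-replicate-zero n)) ⟩
  h zero xor false
    ≡⟨ xor-identityʳ (h zero) ⟩
  h zero ∎
sum-select {ℕ.suc n} h (suc k) = cong₂ _xor_ (∧-zeroʳ (h zero)) (sum-select (h ∘ suc) k)

weight-indicator : ∀ {n} (k : Fin n) → weight (tabulate λ i → does (i ≟ k)) ≡ 1
weight-indicator {ℕ.suc n} zero    = cong ℕ.suc (weight-allFalse n)
  where
  weight-allFalse : ∀ n → weight (tabulate {n = n} λ _ → false) ≡ 0
  weight-allFalse ℕ.zero    = refl
  weight-allFalse (ℕ.suc n) = weight-allFalse n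
weight-indicator {ℕ.suc n} (suc k) = weight-indicator k

permutation-⇔ : ∀ {n} (π : Permutation′ n) {i j} → (j ≡ π ⟨$⟩ʳ i) ⇔ (i ≡ π ⟨$⟩ˡ j)
permutation-⇔ π = mk⇔ (λ j≡πi → sym (trans (cong (π ⟨$⟩ˡ_) j≡πi) (Perm.inverseˡ π)))
                      (λ i≡π⁻¹j → sym (trans (cong (π ⟨$⟩ʳ_) i≡π⁻¹j) (Perm.inverseʳ π)))

permute : ∀ {A : Set} {n} → Permutation′ n → Vec A n → Vec A n
permute ρ u = tabulate (lookup u ∘ (ρ ⟨$⟩ʳ_))

permute-flip : ∀ {A : Set} {n} (ρ : Permutation′ n) (v : Vec A n) →
               permute ρ (permute (Perm.flip ρ) v) ≡ v
permute-flip ρ v = lookup-extensionality λ i → begin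
  lookup (permute ρ (permute (Perm.flip ρ) v)) i ≡⟨ lookup∘tabulate _ i ⟩
  lookup (permute (Perm.flip ρ) v) (ρ ⟨$⟩ʳ i)     ≡⟨ lookup∘tabulate _ (ρ ⟨$⟩ʳ i) ⟩
  lookup v (ρ ⟨$⟩ˡ (ρ ⟨$⟩ʳ i))                    ≡⟨ cong (lookup v) (Perm.inverseˡ ρ) ⟩
  lookup v i                                     ∎

permutationMatrix : ∀ {n} → Permutation′ n → Matrix n n
permutationMatrix π = tabulate λ i → tabulate λ j → does (j ≟ π ⟨$⟩ʳ i)

entry-permutationMatrix : ∀ {n} (π : Permutation′ n) i j →
                          entry (permutationMatrix π) i j ≡ does (i ≟ π ⟨$⟩ˡ j)
entry-permutationMatrix π i j =
  trans (entry-tabulate _ i j) (does-⇔ (permutation-⇔ π) (j ≟ _) (i ≟ _))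

permutationMatrix-isMonomial : ∀ {n} (π : Permutation′ n) → IsMonomial (permutationMatrix π)
permutationMatrix-isMonomial π = row , column
  where
  row : ∀ i → weight (lookup (permutationMatrix π) i) ≡ 1
  row i = trans (cong weight (lookup∘tabulate _ i)) (weight-indicator (π ⟨$⟩ʳ i))
  column : ∀ j → weight (tabulate λ i → entry (permutationMatrix π) i j) ≡ 1
  column j = trans (cong weight (tabulate-cong λ i → entry-permutationMatrix π i j))
                   (weight-indicator (π ⟨$⟩ˡ j))

lookup-·-permutationMatrix : ∀ {n} (x : Vec F₂ n) (π : Permutation′ n) j →
                             lookup (x · permutationMatrix π) j ≡ lookup x (π ⟨$⟩ˡ j)
lookup-·-permutationMatrix x π j = begin
  lookup (x · permutationMatrix π) j                        ≡⟨ lookup-· x _ j ⟩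
  sum (λ i → lookup x i ∧ entry (permutationMatrix π) i j)
    ≡⟨ sum-cong-≗ (λ i → cong (lookup x i ∧_) (entry-permutationMatrix π i j)) ⟩
  sum (λ i → lookup x i ∧ does (i ≟ π ⟨$⟩ˡ j))              ≡⟨ sum-select (lookup x) _ ⟩
  lookup x (π ⟨$⟩ˡ j)                                      ∎

≅Code-permuted : ∀ {m n} (G G' : Matrix m n) (ρ : Permutation′ m) (π : Permutation′ n) →
                 (∀ i j → entry G' i j ≡ entry G (ρ ⟨$⟩ʳ i) (π ⟨$⟩ˡ j)) → G ≅Code G'
≅Code-permuted G G' ρ π G'-entries =
  P , permutationMatrix-isMonomial π , λ y → mk⇔ (to y) (from y)
  where
  P = permutationMatrix π

  ·-P : ∀ u → (u · G) · P ≡ permute ρ u · G'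
  ·-P u = lookup-extensionality λ j → begin
    lookup ((u · G) · P) j                                  ≡⟨ lookup-·-permutationMatrix (u · G) π j ⟩
    lookup (u · G) (π ⟨$⟩ˡ j)                               ≡⟨ lookup-· u G _ ⟩
    sum (λ i → lookup u i ∧ entry G i (π ⟨$⟩ˡ j))            ≡⟨ ∑-permute _ ρ ⟩
    sum (λ i → lookup u (ρ ⟨$⟩ʳ i) ∧ entry G (ρ ⟨$⟩ʳ i) (π ⟨$⟩ˡ j))
      ≡⟨ sum-cong-≗ (λ i → sym (cong₂ _∧_ (lookup∘tabulate _ i) (G'-entries i j))) ⟩
    sum (λ i → lookup (permute ρ u) i ∧ entry G' i j)       ≡⟨ lookup-· (permute ρ u) G' j ⟨
    lookup (permute ρ u · G') j                             ∎

  to : ∀ y → y ∈Code G' → ∃ λ x → x ∈Code G × y ≡ x · P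
  to y (v , y≡vG') = u · G , (u , refl) , (begin
    y                 ≡⟨ y≡vG' ⟩
    v · G'            ≡⟨ cong (_· G') (permute-flip ρ v) ⟨
    permute ρ u · G'  ≡⟨ ·-P u ⟨
    (u · G) · P       ∎)
    where u = permute (Perm.flip ρ) v

  from : ∀ y → (∃ λ x → x ∈Code G × y ≡ x · P) → y ∈Code G'
  from y (x , (u , x≡uG) , y≡xP) = permute ρ u , trans y≡xP (trans (cong (_· P) x≡uG) (·-P u))

≅Code-refl : ∀ {m n} (G : Matrix m n) → G ≅Code G
≅Code-refl G = ≅Code-permuted G G Perm.id Perm.id λ _ _ → refl

<ᵇ-true : ∀ {x y} → x ℕ.< y → (x <ᵇ y) ≡ true
<ᵇ-true {x} {y} x<y = det (<ᵇ-reflects-< x y) (ofʸ x<y)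

<ᵇ-false : ∀ {x y} → ¬ x ℕ.< y → (x <ᵇ y) ≡ false
<ᵇ-false {x} {y} x≮y = det (<ᵇ-reflects-< x y) (ofⁿ x≮y)

[o∸m]∸[o∸n]≡n∸m : ∀ {m n o} → m ≤ o → n ≤ o → (o ∸ m) ∸ (o ∸ n) ≡ n ∸ m
[o∸m]∸[o∸n]≡n∸m {ℕ.zero}  {n}       {o}       _         n≤o       = m∸[m∸n]≡n n≤o
[o∸m]∸[o∸n]≡n∸m {ℕ.suc m} {ℕ.zero}  {o}       _         _         = m≤n⇒m∸n≡0 (m∸n≤m o (ℕ.suc m))
[o∸m]∸[o∸n]≡n∸m {ℕ.suc m} {ℕ.suc n} {ℕ.suc o} (s≤s m≤o) (s≤s n≤o) = [o∸m]∸[o∸n]≡n∸m m≤o n≤o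

opposite-∸ : ∀ {n} (i j : Fin n) → toℕ (opposite i) ∸ toℕ (opposite j) ≡ toℕ j ∸ toℕ i
opposite-∸ i j rewrite opposite-prop i | opposite-prop j = [o∸m]∸[o∸n]≡n∸m (toℕ<n i) (toℕ<n j)

opposite-< : ∀ {n} {i j : Fin n} → i Fin.< j → opposite j Fin.< opposite i
opposite-< {i = i} {j} i<j = m∸n≢0⇒n<m λ eq → m>n⇒m∸n≢0 i<j (trans (sym (opposite-∸ i j)) eq)

toeplitzEntry : ∀ {k} → F₂ → Vec F₂ k → Vec F₂ k → ℕ → ℕ → F₂
toeplitzEntry t a b x y =
  if x <ᵇ y then coeff a (y ∸ x) else if y <ᵇ x then coeff b (x ∸ y) else t

Toeplitz-entry : ∀ {k} t (a b : Vec F₂ k) i j →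
                 entry (Toeplitz t a b) i j ≡ toeplitzEntry t a b (toℕ i) (toℕ j)
Toeplitz-entry t a b zero    zero    = refl
Toeplitz-entry t a b zero    (suc j) = lookup∘tabulate _ j
Toeplitz-entry t a b (suc i) zero    = cong (λ row → lookup row zero) (lookup∘tabulate _ i)
Toeplitz-entry t a b (suc i) (suc j) = unfold refl
  where
  -- The entry function of Toeplitz is local to its definition and cannot be named, so it is
  -- exposed by matching on the equation that unfolds the two tabulations.
  unfold : ∀ {w} → entry (Toeplitz t a b) (suc i) (suc j) ≡ w →
           w ≡ toeplitzEntry t a b (toℕ (suc i)) (toℕ (suc j))
  unfold e with trans (sym e) (trans (cong (λ row → lookup row (suc j)) (lookup∘tabulate _ i))
                                     (lookup∘tabulate _ j))
  ... | refl with toℕ i <ᵇ toℕ j | toℕ j <ᵇ toℕ i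
  ... | true  | _     = refl
  ... | false | true  = refl
  ... | false | false = refl

module _ {k} (t : F₂) (a b : Vec F₂ k) where

  Toeplitz-above : ∀ {i j} → i Fin.< j → entry (Toeplitz t a b) i j ≡ coeff a (toℕ j ∸ toℕ i)
  Toeplitz-above {i} {j} i<j rewrite Toeplitz-entry t a b i j | <ᵇ-true i<j = refl

  Toeplitz-below : ∀ {i j} → j Fin.< i → entry (Toeplitz t a b) i j ≡ coeff b (toℕ i ∸ toℕ j)
  Toeplitz-below {i} {j} j<i
    rewrite Toeplitz-entry t a b i j | <ᵇ-false (<⇒≯ j<i) | <ᵇ-true j<i = refl

  Toeplitz-diagonal : ∀ i → entry (Toeplitz t a b) i i ≡ t
  Toeplitz-diagonal i rewrite Toeplitz-entry t a b i i | <ᵇ-false (<-irrefl {toℕ i} refl) = refl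

Toeplitz-opposite : ∀ {k} t (a b : Vec F₂ k) i j →
                    entry (Toeplitz t b a) i j ≡ entry (Toeplitz t a b) (opposite i) (opposite j)
Toeplitz-opposite t a b i j with <-cmp i j
... | tri< i<j _ _ = begin
  entry (Toeplitz t b a) i j                         ≡⟨ Toeplitz-above t b a i<j ⟩
  coeff b (toℕ j ∸ toℕ i)                            ≡⟨ cong (coeff b) (opposite-∸ i j) ⟨
  coeff b (toℕ (opposite i) ∸ toℕ (opposite j))      ≡⟨ Toeplitz-below t a b (opposite-< i<j) ⟨
  entry (Toeplitz t a b) (opposite i) (opposite j)   ∎
... | tri≈ _ refl _ = trans (Toeplitz-diagonal t b a i) (sym (Toeplitz-diagonal t a b (opposite i)))
... | tri> _ _ j<i = begin
  entry (Toeplitz t b a) i j                         ≡⟨ Toeplitz-below t b a j<i ⟩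
  coeff a (toℕ i ∸ toℕ j)                            ≡⟨ cong (coeff a) (opposite-∸ j i) ⟨
  coeff a (toℕ (opposite j) ∸ toℕ (opposite i))      ≡⟨ Toeplitz-above t a b (opposite-< j<i) ⟨
  entry (Toeplitz t a b) (opposite i) (opposite j)   ∎

I-permute : ∀ {n} (π : Permutation′ n) i j → entry (I n) i j ≡ entry (I n) (π ⟨$⟩ʳ i) (π ⟨$⟩ʳ j)
I-permute {n} π i j = begin
  entry (I n) i j                           ≡⟨ entry-tabulate _ i j ⟩
  does (i ≟ j)                              ≡⟨ does-⇔ π-injective⇔ (i ≟ j) (π ⟨$⟩ʳ i ≟ π ⟨$⟩ʳ j) ⟩
  does (π ⟨$⟩ʳ i ≟ π ⟨$⟩ʳ j)                ≡⟨ entry-tabulate _ (π ⟨$⟩ʳ i) (π ⟨$⟩ʳ j) ⟨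
  entry (I n) (π ⟨$⟩ʳ i) (π ⟨$⟩ʳ j)         ∎
  where π-injective⇔ = mk⇔ (cong (π ⟨$⟩ʳ_)) (Injection.injective (↔⇒↣ π))

entry-∣∣ˡ : ∀ {m n p} (A : Matrix m n) (B : Matrix m p) i c →
            entry (A ∣∣ B) i (c ↑ˡ p) ≡ entry A i c
entry-∣∣ˡ A B i c = trans (cong (λ row → lookup row (c ↑ˡ _)) (lookup-zipWith _++_ i A B))
                          (lookup-++ˡ (lookup A i) (lookup B i) c)

entry-∣∣ʳ : ∀ {m n p} (A : Matrix m n) (B : Matrix m p) i c →
            entry (A ∣∣ B) i (n ↑ʳ c) ≡ entry B i c
entry-∣∣ʳ {n = n} A B i c = trans (cong (λ row → lookup row (n ↑ʳ c)) (lookup-zipWith _++_ i A B))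
                                  (lookup-++ʳ (lookup A i) (lookup B i) c)

oppositeBlocks : ∀ m n → Fin (m ℕ.+ n) → Fin (m ℕ.+ n)
oppositeBlocks m n = join m n ∘ Sum.map opposite opposite ∘ splitAt m

oppositeBlocks-↑ˡ : ∀ m n (c : Fin m) → oppositeBlocks m n (c ↑ˡ n) ≡ opposite c ↑ˡ n
oppositeBlocks-↑ˡ m n c = cong (join m n ∘ Sum.map opposite opposite) (splitAt-↑ˡ m c n)

oppositeBlocks-↑ʳ : ∀ m n (c : Fin n) → oppositeBlocks m n (m ↑ʳ c) ≡ m ↑ʳ opposite c
oppositeBlocks-↑ʳ m n c = cong (join m n ∘ Sum.map opposite opposite) (splitAt-↑ʳ m n c)

oppositeBlocks-involutive : ∀ m n j → oppositeBlocks m n (oppositeBlocks m n j) ≡ j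
oppositeBlocks-involutive m n j = begin
  join m n (opp (splitAt m (join m n (opp (splitAt m j)))))
    ≡⟨ cong (join m n ∘ opp) (splitAt-join m n (opp (splitAt m j))) ⟩
  join m n (opp (opp (splitAt m j)))   ≡⟨ cong (join m n) (opp-involutive (splitAt m j)) ⟩
  join m n (splitAt m j)               ≡⟨ join-splitAt m n j ⟩
  j                                    ∎
  where
  opp : Fin m ⊎ Fin n → Fin m ⊎ Fin n
  opp = Sum.map opposite opposite
  opp-involutive : ∀ s → opp (opp s) ≡ s
  opp-involutive (inj₁ c) = cong inj₁ (opposite-involutive c)
  opp-involutive (inj₂ c) = cong inj₂ (opposite-involutive c)

reverseBlocks : ∀ m n → Permutation′ (m ℕ.+ n)
reverseBlocks m n = Perm.permutation (oppositeBlocks m n) (oppositeBlocks m n)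
                      (oppositeBlocks-involutive m n) (oppositeBlocks-involutive m n)

DTGen-swap-entries : ∀ {k} t (a b : Vec F₂ k) i j →
  entry (DTGen t b a) i j ≡ entry (DTGen t a b) (opposite i) (oppositeBlocks (ℕ.suc k) (ℕ.suc k) j)
DTGen-swap-entries {k} t a b i j =
  subst (λ j → entry (DTGen t b a) i j ≡ entry (DTGen t a b) (opposite i) (σ j))
        (join-splitAt m m j) (onBlock (splitAt m j))
  where
  m = ℕ.suc k
  σ = oppositeBlocks m m
  onBlock : ∀ s → entry (DTGen t b a) i (join m m s) ≡ entry (DTGen t a b) (opposite i) (σ (join m m s))
  onBlock (inj₁ c) = begin
    entry (DTGen t b a) i (c ↑ˡ m)                       ≡⟨ entry-∣∣ˡ (I m) (Toeplitz t b a) i c ⟩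
    entry (I m) i c                                      ≡⟨ I-permute Perm.reverse i c ⟩
    entry (I m) (opposite i) (opposite c)                ≡⟨ entry-∣∣ˡ (I m) (Toeplitz t a b) (opposite i) (opposite c) ⟨
    entry (DTGen t a b) (opposite i) (opposite c ↑ˡ m)   ≡⟨ cong (entry (DTGen t a b) (opposite i)) (oppositeBlocks-↑ˡ m m c) ⟨
    entry (DTGen t a b) (opposite i) (σ (c ↑ˡ m))        ∎
  onBlock (inj₂ c) = begin
    entry (DTGen t b a) i (m ↑ʳ c)                       ≡⟨ entry-∣∣ʳ (I m) (Toeplitz t b a) i c ⟩
    entry (Toeplitz t b a) i c                           ≡⟨ Toeplitz-opposite t a b i c ⟩
    entry (Toeplitz t a b) (opposite i) (opposite c)     ≡⟨ entry-∣∣ʳ (I m) (Toeplitz t a b) (opposite i) (opposite c) ⟨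
    entry (DTGen t a b) (opposite i) (m ↑ʳ opposite c)   ≡⟨ cong (entry (DTGen t a b) (opposite i)) (oppositeBlocks-↑ʳ m m c) ⟨
    entry (DTGen t a b) (opposite i) (σ (m ↑ʳ c))        ∎

DTGen-swap-≅Code : ∀ {k} t (a b : Vec F₂ k) → DTGen t a b ≅Code DTGen t b a
DTGen-swap-≅Code {k} t a b =
  ≅Code-permuted _ _ Perm.reverse (reverseBlocks (ℕ.suc k) (ℕ.suc k)) (DTGen-swap-entries t a b)

∷-mono-≥F : ∀ {k} x {c c' : Vec F₂ k} → c ≥F c' → (x ∷ c) ≥F (x ∷ c')
∷-mono-≥F x c≥c' = +-monoʳ-≤ (g x) (*-monoʳ-≤ 2 c≥c')

lemma5p2 : (k : ℕ) (t : F₂) (a b : Vec F₂ k) →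
    Σ F₂ λ t' → Σ (Vec F₂ k) λ a' → Σ (Vec F₂ k) λ b' →
      (DTGen t a b ≅Code DTGen t' a' b') × ((t' ∷ a') ≥F (t' ∷ b'))
lemma5p2 k t a b with ≤-total (f b) (f a)
... | inj₁ a≥b = t , a , b , ≅Code-refl (DTGen t a b) , ∷-mono-≥F t {a} {b} a≥b
... | inj₂ b≥a = t , b , a , DTGen-swap-≅Code t a b , ∷-mono-≥F t {b} {a} b≥a
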